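{- Let $H$ be the Hilbert system for classical propositional modal logic (with $\lozenge$ primitive) whose axioms are all classical propositional tautologies, $\lozenge(\varphi\vee\psi)\leftrightarrow(\lozenge\varphi\vee\lozenge\psi)$, $\neg\lozenge\bot$, and the schemata $\varphi\rightarrow\lozenge\varphi$, $\lozenge\lozenge\varphi\rightarrow\lozenge\varphi$, $(\lozenge\varphi\wedge\psi)\rightarrow\lozenge(\varphi\wedge\lozenge\psi)$, and whose rules are modus ponens and: from $\varphi\leftrightarrow\psi$ infer $\lozenge\varphi\leftrightarrow\lozenge\psi$. Then $H$ is a complete axiomatization of the modal system S5, i.e. the theorems of $H$ are exactly the theorems of S5.
   Context: Formulas are built from a set of propositional symbols with $\neg$, $\vee$, $\lozenge$; $\wedge,\rightarrow,\leftrightarrow,\bot$ are the usual abbreviations and $\square=\neg\lozenge\neg$. S5 is the standard normal modal logic whose theorems are the formulas valid in all Kripke models with an equivalence relation as accessibility relation (equivalently K plus T, 4 and $\varphi\rightarrow\square\lozenge\varphi$). -}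

module Defs where

open import Data.Nat using (ℕ)
open import Data.Bool using (Bool; true; false; not; _∨_)
open import Data.Empty using (⊥)
open import Data.Sum using (_⊎_)
open import Data.Product using (Σ; _×_)
open import Relation.Binary.PropositionalEquality using (_≡_)
open import Relation.Binary.Structures using (IsEquivalence)
open import Level using (0ℓ)

data Fm : Set where
  var : ℕ → Fm
  ¬'_ : Fm → Fm
  _∨'_ : Fm → Fm → Fm
  ◇_ : Fm → Fm

infixr 20 ¬'_ ◇_
infixl 15 _∨'_
infixl 16 _∧'_
infixr 14 _⇒_
infix 13 _⇔_

_∧'_ : Fm → Fm → Fm
φ ∧' ψ = ¬' (¬' φ ∨' ¬' ψ)

_⇒_ : Fm → Fm → Fm
φ ⇒ ψ = ¬' φ ∨' ψ

_⇔_ : Fm → Fm → Fm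
φ ⇔ ψ = (φ ⇒ ψ) ∧' (ψ ⇒ φ)

⊥' : Fm
⊥' = ¬' (var 0 ∨' ¬' var 0)

□_ : Fm → Fm
□ φ = ¬' ◇ ¬' φ

-- Classical propositional tautologies (in the modal language): a boolean
-- valuation respecting ¬ and ∨, but arbitrary on atoms and on ◇-formulas
-- (which are treated as propositional atoms).
record BoolVal : Set where
  field
    val   : Fm → Bool
    val-¬ : ∀ φ → val (¬' φ) ≡ not (val φ)
    val-∨ : ∀ φ ψ → val (φ ∨' ψ) ≡ (val φ ∨ val ψ)

Tautology : Fm → Set
Tautology φ = (v : BoolVal) → BoolVal.val v φ ≡ true

data H⊢_ : Fm → Set where
  taut    : ∀ {φ} → Tautology φ → H⊢ φ
  ax-◇∨   : ∀ φ ψ → H⊢ (◇ (φ ∨' ψ) ⇔ (◇ φ ∨' ◇ ψ))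
  ax-¬◇⊥  : H⊢ (¬' ◇ ⊥')
  ax-T    : ∀ φ → H⊢ (φ ⇒ ◇ φ)
  ax-4    : ∀ φ → H⊢ (◇ ◇ φ ⇒ ◇ φ)
  ax-5    : ∀ φ ψ → H⊢ ((◇ φ ∧' ψ) ⇒ ◇ (φ ∧' ◇ ψ))
  mp      : ∀ {φ ψ} → H⊢ (φ ⇒ ψ) → H⊢ φ → H⊢ ψ
  cong◇   : ∀ {φ ψ} → H⊢ (φ ⇔ ψ) → H⊢ (◇ φ ⇔ ◇ ψ)

record Model : Set₁ where
  field
    W     : Set
    R     : W → W → Set
    V     : ℕ → W → Set

_,_⊨_ : (M : Model) → Model.W M → Fm → Set
M , w ⊨ var p   = Model.V M p w
M , w ⊨ (¬' φ)  = M , w ⊨ φ → ⊥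
M , w ⊨ (φ ∨' ψ) = (M , w ⊨ φ) ⊎ (M , w ⊨ ψ)
M , w ⊨ (◇ φ)   = Σ (Model.W M) (λ v → Model.R M w v × (M , v ⊨ φ))

S5-valid : Fm → Set₁
S5-valid φ = (M : Model) → IsEquivalence (Model.R M) →
             (w : Model.W M) → M , w ⊨ φ

-- Soundness is a check of each axiom on an equivalence relation. Completeness is
-- the canonical model construction: worlds are the maximal consistent sets, and
-- Γ R Δ holds when ◇ φ ∈ Γ for every φ ∈ Δ. The axioms φ ⇒ ◇ φ and ◇ ◇ φ ⇒ ◇ φ
-- make R reflexive and transitive, and (◇ φ ∧ ψ) ⇒ ◇ (φ ∧ ◇ ψ) makes it symmetric.
-- The distribution of ◇ over ∨, the rule for ◇ under equivalence and ¬ ◇ ⊥ are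
-- what the existence lemma needs: if ◇ ψ ∈ Γ, then ψ together with every ¬ χ with
-- ¬ ◇ χ ∈ Γ is consistent, and any maximal extension is an R-successor of Γ.
-- Excluded middle is used to evaluate tautologies in Kripke models and to build
-- maximal consistent sets.
module Submission where

open import Defs
open import Axiom.DoubleNegationElimination using (DoubleNegationElimination; em⇒dne)
open import Axiom.ExcludedMiddle using (ExcludedMiddle)
open import Level using (0ℓ)
open import Data.Bool using (Bool; true; false; not; _∧_; _∨_; T)
open import Data.Bool.Properties using (T-≡; T-∧; ∨-inverseʳ)
open import Data.Empty using (⊥; ⊥-elim)
open import Data.Fin using (Fin; zero; suc)
open import Data.List using (List; []; _∷_; _++_; map; cartesianProductWith)
open import Data.List.Membership.Propositional using (_∈_)
open import Data.List.Membership.Propositional.Properties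
  using (∈-map⁺; ∈-++⁺ˡ; ∈-++⁺ʳ; ∈-cartesianProductWith⁺)
open import Data.List.Relation.Unary.All as All using (All; []; _∷_)
open import Data.List.Relation.Unary.All.Properties using (++⁺)
open import Data.List.Relation.Unary.Any using (here; there)
open import Data.Nat using (ℕ; zero; suc; _⊔_; _≤′_; ≤′-refl; ≤′-step)
open import Data.Nat.Properties using (m≤m⊔n; m≤n⊔m; ≤⇒≤′)
open import Data.Product using (∃-syntax; _×_; _,_; proj₁; proj₂)
open import Data.Sum using (_⊎_; inj₁; inj₂; [_,_])
import Data.Sum as Sum
open import Data.Vec using (Vec; []; _∷_; lookup)
import Data.Vec as Vec
open import Data.Vec.Properties using (lookup-map)
open import Function using (_∘_)
open import Function.Bundles using (Equivalence)
open import Relation.Nullary using (¬_; Dec; yes; no)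
open import Relation.Nullary.Decidable using (isYes; toWitness; fromWitness)
open import Relation.Binary.PropositionalEquality
  using (_≡_; refl; sym; trans; cong; cong₂; module ≡-Reasoning)
open import Relation.Binary.Structures using (IsEquivalence)

-- Propositional schemas and their substitution instances

data Schema (n : ℕ) : Set where
  atom : Fin n → Schema n
  ⊥ₛ   : Schema n
  ¬ₛ_  : Schema n → Schema n
  _∨ₛ_ : Schema n → Schema n → Schema n

infixr 20 ¬ₛ_
infixl 15 _∨ₛ_
infixl 16 _∧ₛ_
infixr 14 _⇒ₛ_
infix 13 _⇔ₛ_

_∧ₛ_ : ∀ {n} → Schema n → Schema n → Schema n
p ∧ₛ q = ¬ₛ (¬ₛ p ∨ₛ ¬ₛ q)

_⇒ₛ_ : ∀ {n} → Schema n → Schema n → Schema n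
p ⇒ₛ q = ¬ₛ p ∨ₛ q

_⇔ₛ_ : ∀ {n} → Schema n → Schema n → Schema n
p ⇔ₛ q = (p ⇒ₛ q) ∧ₛ (q ⇒ₛ p)

⊤ₛ : ∀ {n} → Schema n
⊤ₛ = ¬ₛ ⊥ₛ

A : ∀ {n} → Schema (suc n)
A = atom zero

B : ∀ {n} → Schema (suc (suc n))
B = atom (suc zero)

C : ∀ {n} → Schema (suc (suc (suc n)))
C = atom (suc (suc zero))

D : ∀ {n} → Schema (suc (suc (suc (suc n))))
D = atom (suc (suc (suc zero)))

E : ∀ {n} → Schema (suc (suc (suc (suc (suc n)))))
E = atom (suc (suc (suc (suc zero))))

⟦_⟧ : ∀ {n} → Schema n → Vec Fm n → Fm
⟦ atom i ⟧ σ = lookup σ i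
⟦ ⊥ₛ ⟧     σ = ⊥'
⟦ ¬ₛ p ⟧   σ = ¬' ⟦ p ⟧ σ
⟦ p ∨ₛ q ⟧ σ = ⟦ p ⟧ σ ∨' ⟦ q ⟧ σ

eval : ∀ {n} → Schema n → Vec Bool n → Bool
eval (atom i) ρ = lookup ρ i
eval ⊥ₛ       ρ = false
eval (¬ₛ p)   ρ = not (eval p ρ)
eval (p ∨ₛ q) ρ = eval p ρ ∨ eval q ρ

valid? : ∀ n → (Vec Bool n → Bool) → Bool
valid? zero    f = f []
valid? (suc n) f = valid? n (f ∘ (true ∷_)) ∧ valid? n (f ∘ (false ∷_))

valid?-sound : ∀ n (f : Vec Bool n → Bool) → T (valid? n f) → ∀ ρ → T (f ρ)
valid?-sound zero    f v [] = v
valid?-sound (suc n) f v (true ∷ ρ) =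
  valid?-sound n _ (proj₁ (Equivalence.to (T-∧ {valid? n (f ∘ (true ∷_))}) v)) ρ
valid?-sound (suc n) f v (false ∷ ρ) =
  valid?-sound n _ (proj₂ (Equivalence.to (T-∧ {valid? n (f ∘ (true ∷_))}) v)) ρ

val-⊥' : (v : BoolVal) → BoolVal.val v ⊥' ≡ false
val-⊥' v = begin
  val (¬' (var 0 ∨' ¬' var 0))          ≡⟨ val-¬ _ ⟩
  not (val (var 0 ∨' ¬' var 0))         ≡⟨ cong not (val-∨ _ _) ⟩
  not (val (var 0) ∨ val (¬' var 0))    ≡⟨ cong (λ b → not (val (var 0) ∨ b)) (val-¬ _) ⟩
  not (val (var 0) ∨ not (val (var 0))) ≡⟨ cong not (∨-inverseʳ (val (var 0))) ⟩
  false                                 ∎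
  where open BoolVal v
        open ≡-Reasoning

val-⟦⟧ : ∀ {n} (v : BoolVal) (p : Schema n) (σ : Vec Fm n) →
         BoolVal.val v (⟦ p ⟧ σ) ≡ eval p (Vec.map (BoolVal.val v) σ)
val-⟦⟧ v (atom i) σ = sym (lookup-map i (BoolVal.val v) σ)
val-⟦⟧ v ⊥ₛ       σ = val-⊥' v
val-⟦⟧ v (¬ₛ p)   σ = trans (BoolVal.val-¬ v _) (cong not (val-⟦⟧ v p σ))
val-⟦⟧ v (p ∨ₛ q) σ = trans (BoolVal.val-∨ v _ _) (cong₂ _∨_ (val-⟦⟧ v p σ) (val-⟦⟧ v q σ))

-- The implicit proof is inferred (T true is the unit type) once the truth table of p evaluates.
tautology : ∀ {n} (p : Schema n) (σ : Vec Fm n) → {_ : T (valid? n (eval p))} → H⊢ ⟦ p ⟧ σ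
tautology {n} p σ {v} =
  taut λ bv → trans (val-⟦⟧ bv p σ) (Equivalence.to T-≡ (valid?-sound n (eval p) v _))

-- Under φ ⇒ ψ, φ ∨ ψ is equivalent to ψ, and ◇ distributes over ∨.
◇-mono : ∀ {φ ψ} → H⊢ (φ ⇒ ψ) → H⊢ (◇ φ ⇒ ◇ ψ)
◇-mono {φ} {ψ} φ⇒ψ =
  mp (mp (tautology ((A ⇔ₛ B) ⇒ₛ (A ⇔ₛ C ∨ₛ B) ⇒ₛ C ⇒ₛ B) (◇ (φ ∨' ψ) ∷ ◇ ψ ∷ ◇ φ ∷ []))
         ◇[φ∨ψ]⇔◇ψ)
     (ax-◇∨ φ ψ)
  where
  ◇[φ∨ψ]⇔◇ψ : H⊢ (◇ (φ ∨' ψ) ⇔ ◇ ψ)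
  ◇[φ∨ψ]⇔◇ψ = cong◇ (mp (tautology ((A ⇒ₛ B) ⇒ₛ (A ∨ₛ B ⇔ₛ B)) (φ ∷ ψ ∷ [])) φ⇒ψ)

isYes-¬ : ∀ {a} {P : Set a} (p? : Dec P) (¬p? : Dec (¬ P)) → isYes ¬p? ≡ not (isYes p?)
isYes-¬ (yes p)  (yes ¬p)  = ⊥-elim (¬p p)
isYes-¬ (yes _)  (no _)    = refl
isYes-¬ (no _)   (yes _)   = refl
isYes-¬ (no ¬p)  (no ¬¬p)  = ⊥-elim (¬¬p ¬p)

isYes-⊎ : ∀ {a b} {P : Set a} {Q : Set b} (p? : Dec P) (q? : Dec Q) (p⊎q? : Dec (P ⊎ Q)) →
          isYes p⊎q? ≡ isYes p? ∨ isYes q?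
isYes-⊎ (yes _)  _        (yes _)   = refl
isYes-⊎ (yes p)  _        (no ¬p⊎q) = ⊥-elim (¬p⊎q (inj₁ p))
isYes-⊎ (no _)   (yes _)  (yes _)   = refl
isYes-⊎ (no _)   (yes q)  (no ¬p⊎q) = ⊥-elim (¬p⊎q (inj₂ q))
isYes-⊎ (no ¬p)  (no ¬q)  (yes p⊎q) = ⊥-elim ([ ¬p , ¬q ] p⊎q)
isYes-⊎ (no _)   (no _)   (no _)    = refl

module Soundness (lem : ExcludedMiddle 0ℓ) where

  dne : DoubleNegationElimination 0ℓ
  dne = em⇒dne lem

  ⇒-intro : {P Q : Set} → (P → Q) → ¬ P ⊎ Q
  ⇒-intro {P} f with lem {P}
  ... | yes p  = inj₂ (f p)
  ... | no ¬p  = inj₁ ¬p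

  ⇒-elim : {P Q : Set} → ¬ P ⊎ Q → P → Q
  ⇒-elim (inj₁ ¬p) p = ⊥-elim (¬p p)
  ⇒-elim (inj₂ q)  _ = q

  ∧-intro : {P Q : Set} → P → Q → ¬ (¬ P ⊎ ¬ Q)
  ∧-intro p q = [ (λ ¬p → ¬p p) , (λ ¬q → ¬q q) ]

  ∧-elimˡ : {P Q : Set} → ¬ (¬ P ⊎ ¬ Q) → P
  ∧-elimˡ p∧q = dne (p∧q ∘ inj₁)

  ∧-elimʳ : {P Q : Set} → ¬ (¬ P ⊎ ¬ Q) → Q
  ∧-elimʳ p∧q = dne (p∧q ∘ inj₂)

  ⇔-intro : {P Q : Set} → (P → Q) → (Q → P) → ¬ (¬ (¬ P ⊎ Q) ⊎ ¬ (¬ Q ⊎ P))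
  ⇔-intro f g = ∧-intro (⇒-intro f) (⇒-intro g)

  ⇔-to : {P Q : Set} → ¬ (¬ (¬ P ⊎ Q) ⊎ ¬ (¬ Q ⊎ P)) → P → Q
  ⇔-to p⇔q = ⇒-elim (∧-elimˡ p⇔q)

  ⇔-from : {P Q : Set} → ¬ (¬ (¬ P ⊎ Q) ⊎ ¬ (¬ Q ⊎ P)) → Q → P
  ⇔-from p⇔q = ⇒-elim (∧-elimʳ p⇔q)

  truthValuation : (M : Model) → Model.W M → BoolVal
  truthValuation M w = record
    { val   = λ φ → isYes (lem {M , w ⊨ φ})
    ; val-¬ = λ φ → isYes-¬ (lem {M , w ⊨ φ}) lem
    ; val-∨ = λ φ ψ → isYes-⊎ (lem {M , w ⊨ φ}) (lem {M , w ⊨ ψ}) lem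
    }

  soundness : ∀ {φ} → H⊢ φ → S5-valid φ
  soundness (taut t) M R-equiv w =
    toWitness (Equivalence.from T-≡ (t (truthValuation M w)))
  soundness (ax-◇∨ φ ψ) M R-equiv w = ⇔-intro
    (λ { (v , wRv , inj₁ p) → inj₁ (v , wRv , p) ; (v , wRv , inj₂ q) → inj₂ (v , wRv , q) })
    [ (λ (v , wRv , p) → v , wRv , inj₁ p) , (λ (v , wRv , q) → v , wRv , inj₂ q) ]
  soundness ax-¬◇⊥ M R-equiv w (v , _ , ¬[p∨¬p]) = ¬[p∨¬p] (inj₂ (¬[p∨¬p] ∘ inj₁))
  soundness (ax-T φ) M R-equiv w = ⇒-intro (λ p → w , IsEquivalence.refl R-equiv , p)
  soundness (ax-4 φ) M R-equiv w =
    ⇒-intro (λ (v , wRv , u , vRu , p) → u , IsEquivalence.trans R-equiv wRv vRu , p)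
  soundness (ax-5 φ ψ) M R-equiv w = ⇒-intro λ ◇φ∧ψ →
    let (v , wRv , p) = ∧-elimˡ ◇φ∧ψ
    in v , wRv , ∧-intro p (w , IsEquivalence.sym R-equiv wRv , ∧-elimʳ ◇φ∧ψ)
  soundness (mp φ⇒ψ φ) M R-equiv w = ⇒-elim (soundness φ⇒ψ M R-equiv w) (soundness φ M R-equiv w)
  soundness (cong◇ φ⇔ψ) M R-equiv w = ⇔-intro
    (λ (v , wRv , p) → v , wRv , ⇔-to (soundness φ⇔ψ M R-equiv v) p)
    (λ (v , wRv , q) → v , wRv , ⇔-from (soundness φ⇔ψ M R-equiv v) q)

⋀ : List Fm → Fm
⋀ []      = ¬' ⊥'
⋀ (φ ∷ L) = φ ∧' ⋀ L

⋁ : List Fm → Fm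
⋁ []      = ⊥'
⋁ (φ ∷ L) = φ ∨' ⋁ L

Consistent : (Fm → Set) → Set
Consistent S = ∀ L → All S L → ¬ H⊢ (¬' ⋀ L)

_∪｛_｝ : (Fm → Set) → Fm → Fm → Set
(S ∪｛ χ ｝) φ = S φ ⊎ φ ≡ χ

⋀-++ : ∀ L₁ L₂ → H⊢ (⋀ (L₁ ++ L₂) ⇒ ⋀ L₁ ∧' ⋀ L₂)
⋀-++ []       L₂ = tautology (A ⇒ₛ ⊤ₛ ∧ₛ A) (⋀ L₂ ∷ [])
⋀-++ (φ ∷ L₁) L₂ = mp (tautology ((A ⇒ₛ B ∧ₛ C) ⇒ₛ D ∧ₛ A ⇒ₛ (D ∧ₛ B) ∧ₛ C)
                                 (⋀ (L₁ ++ L₂) ∷ ⋀ L₁ ∷ ⋀ L₂ ∷ φ ∷ []))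
                      (⋀-++ L₁ L₂)

split-∪｛｝ : ∀ {S χ} L → All (S ∪｛ χ ｝) L → ∃[ L′ ] All S L′ × H⊢ (χ ∧' ⋀ L′ ⇒ ⋀ L)
split-∪｛｝ {χ = χ} [] [] = [] , [] , tautology (A ∧ₛ ⊤ₛ ⇒ₛ ⊤ₛ) (χ ∷ [])
split-∪｛｝ {χ = χ} (φ ∷ L) (inj₁ φ∈S ∷ L⊆S∪χ) with split-∪｛｝ L L⊆S∪χ
... | L′ , L′⊆S , χ∧L′⇒L =
  φ ∷ L′ , φ∈S ∷ L′⊆S ,
  mp (tautology ((A ∧ₛ B ⇒ₛ C) ⇒ₛ A ∧ₛ (D ∧ₛ B) ⇒ₛ D ∧ₛ C) (χ ∷ ⋀ L′ ∷ ⋀ L ∷ φ ∷ [])) χ∧L′⇒L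
split-∪｛｝ {χ = χ} (φ ∷ L) (inj₂ refl ∷ L⊆S∪χ) with split-∪｛｝ L L⊆S∪χ
... | L′ , L′⊆S , χ∧L′⇒L =
  L′ , L′⊆S ,
  mp (tautology ((A ∧ₛ B ⇒ₛ C) ⇒ₛ A ∧ₛ B ⇒ₛ A ∧ₛ C) (χ ∷ ⋀ L′ ∷ ⋀ L ∷ [])) χ∧L′⇒L

-- If S ∪ {χ} and S ∪ {¬ χ} both refute finite subsets, then χ ∧ ⋀ L₁ and
-- ¬ χ ∧ ⋀ L₂ are refutable with L₁, L₂ ⊆ S, hence so is ⋀ (L₁ ++ L₂).
∪｛¬｝-consistent : ∀ {S} χ → Consistent S → ¬ Consistent (S ∪｛ χ ｝) →
                   Consistent (S ∪｛ ¬' χ ｝)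
∪｛¬｝-consistent χ S-con ¬S∪χ-con L₂ L₂⊆S∪¬χ ⊢¬L₂ = ¬S∪χ-con λ L₁ L₁⊆S∪χ ⊢¬L₁ →
  let L₁′ , L₁′⊆S , χ∧L₁′⇒L₁   = split-∪｛｝ L₁ L₁⊆S∪χ
      L₂′ , L₂′⊆S , ¬χ∧L₂′⇒L₂  = split-∪｛｝ L₂ L₂⊆S∪¬χ
      ⊢¬[L₁′∧L₂′] = mp (mp (mp (mp
        (tautology ((A ∧ₛ B ⇒ₛ C) ⇒ₛ ¬ₛ C ⇒ₛ (¬ₛ A ∧ₛ D ⇒ₛ E) ⇒ₛ ¬ₛ E ⇒ₛ ¬ₛ (B ∧ₛ D))
                   (χ ∷ ⋀ L₁′ ∷ ⋀ L₁ ∷ ⋀ L₂′ ∷ ⋀ L₂ ∷ []))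
        χ∧L₁′⇒L₁) ⊢¬L₁) ¬χ∧L₂′⇒L₂) ⊢¬L₂
  in S-con (L₁′ ++ L₂′) (++⁺ L₁′⊆S L₂′⊆S)
       (mp (mp (tautology ((A ⇒ₛ B ∧ₛ C) ⇒ₛ ¬ₛ (B ∧ₛ C) ⇒ₛ ¬ₛ A)
                          (⋀ (L₁′ ++ L₂′) ∷ ⋀ L₁′ ∷ ⋀ L₂′ ∷ []))
               (⋀-++ L₁′ L₂′))
           ⊢¬[L₁′∧L₂′])

｛¬｝-consistent : ∀ φ → ¬ H⊢ φ → Consistent (_≡ ¬' φ)
｛¬｝-consistent φ ⊬φ L L≡¬φ ⊢¬L =
  ⊬φ (mp (mp (tautology ((¬ₛ A ⇒ₛ B) ⇒ₛ ¬ₛ B ⇒ₛ A) (φ ∷ ⋀ L ∷ [])) (¬φ⇒⋀ L L≡¬φ)) ⊢¬L)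
  where
  ¬φ⇒⋀ : ∀ L → All (_≡ ¬' φ) L → H⊢ (¬' φ ⇒ ⋀ L)
  ¬φ⇒⋀ [] [] = tautology (A ⇒ₛ ⊤ₛ) (¬' φ ∷ [])
  ¬φ⇒⋀ (_ ∷ L) (refl ∷ L≡¬φ) =
    mp (tautology ((A ⇒ₛ B) ⇒ₛ A ⇒ₛ A ∧ₛ B) (¬' φ ∷ ⋀ L ∷ [])) (¬φ⇒⋀ L L≡¬φ)

-- Enumerating formulas

formulasBelow : ℕ → List Fm
formulasBelow zero    = []
formulasBelow (suc n) =
  var n ∷ fs ++ map ¬'_ fs ++ map ◇_ fs ++ cartesianProductWith _∨'_ fs fs
  where fs = formulasBelow n

formulasBelow-mono : ∀ {m n φ} → m ≤′ n → φ ∈ formulasBelow m → φ ∈ formulasBelow n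
formulasBelow-mono ≤′-refl        φ∈ = φ∈
formulasBelow-mono (≤′-step m≤′n) φ∈ = there (∈-++⁺ˡ (formulasBelow-mono m≤′n φ∈))

formulasBelow-complete : ∀ φ → ∃[ n ] φ ∈ formulasBelow n
formulasBelow-complete (var k) = suc k , here refl
formulasBelow-complete (¬' φ) =
  let n , φ∈ = formulasBelow-complete φ
      fs = formulasBelow n
  in suc n , there (∈-++⁺ʳ fs (∈-++⁺ˡ (∈-map⁺ ¬'_ φ∈)))
formulasBelow-complete (◇ φ) =
  let n , φ∈ = formulasBelow-complete φ
      fs = formulasBelow n
  in suc n , there (∈-++⁺ʳ fs (∈-++⁺ʳ (map ¬'_ fs) (∈-++⁺ˡ (∈-map⁺ ◇_ φ∈))))
formulasBelow-complete (φ ∨' ψ) =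
  let m , φ∈ = formulasBelow-complete φ
      n , ψ∈ = formulasBelow-complete ψ
      fs = formulasBelow (m ⊔ n)
      φ∨ψ∈ = ∈-cartesianProductWith⁺ _∨'_ (formulasBelow-mono (≤⇒≤′ (m≤m⊔n m n)) φ∈)
                                          (formulasBelow-mono (≤⇒≤′ (m≤n⊔m m n)) ψ∈)
  in suc (m ⊔ n) , there (∈-++⁺ʳ fs (∈-++⁺ʳ (map ¬'_ fs) (∈-++⁺ʳ (map ◇_ fs) φ∨ψ∈)))

-- Maximal consistent sets

-- Membership is Bool-valued so that the canonical model has a carrier in Set.
record MCS : Set where
  field
    member     : Fm → Bool
    consistent : Consistent (T ∘ member)
    decides    : ∀ φ → T (member φ) ⊎ T (member (¬' φ))

open MCS

infix 4 _∋_

_∋_ : MCS → Fm → Set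
Γ ∋ φ = T (member Γ φ)

module _ (Γ : MCS) where

  ∋-contradiction : ∀ {φ} → Γ ∋ φ → Γ ∋ ¬' φ → ⊥
  ∋-contradiction {φ} φ∈ ¬φ∈ =
    consistent Γ (φ ∷ ¬' φ ∷ []) (φ∈ ∷ ¬φ∈ ∷ []) (tautology (¬ₛ (A ∧ₛ (¬ₛ A ∧ₛ ⊤ₛ))) (φ ∷ []))

  ∋-theorem : ∀ {φ} → H⊢ φ → Γ ∋ φ
  ∋-theorem {φ} ⊢φ with decides Γ φ
  ... | inj₁ φ∈  = φ∈
  ... | inj₂ ¬φ∈ = ⊥-elim (consistent Γ (¬' φ ∷ []) (¬φ∈ ∷ [])
                             (mp (tautology (A ⇒ₛ ¬ₛ (¬ₛ A ∧ₛ ⊤ₛ)) (φ ∷ [])) ⊢φ))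

  ∋-mp : ∀ {φ ψ} → Γ ∋ (φ ⇒ ψ) → Γ ∋ φ → Γ ∋ ψ
  ∋-mp {φ} {ψ} φ⇒ψ∈ φ∈ with decides Γ ψ
  ... | inj₁ ψ∈  = ψ∈
  ... | inj₂ ¬ψ∈ = ⊥-elim (consistent Γ ((φ ⇒ ψ) ∷ φ ∷ ¬' ψ ∷ []) (φ⇒ψ∈ ∷ φ∈ ∷ ¬ψ∈ ∷ [])
                             (tautology (¬ₛ ((A ⇒ₛ B) ∧ₛ (A ∧ₛ (¬ₛ B ∧ₛ ⊤ₛ)))) (φ ∷ ψ ∷ [])))

  ∋-by₁ : ∀ {φ ψ} → H⊢ (φ ⇒ ψ) → Γ ∋ φ → Γ ∋ ψ
  ∋-by₁ ⊢φ⇒ψ = ∋-mp (∋-theorem ⊢φ⇒ψ)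

  ∋-by₂ : ∀ {φ ψ χ} → H⊢ (φ ⇒ ψ ⇒ χ) → Γ ∋ φ → Γ ∋ ψ → Γ ∋ χ
  ∋-by₂ ⊢φ⇒ψ⇒χ φ∈ = ∋-mp (∋-by₁ ⊢φ⇒ψ⇒χ φ∈)

  ∋-∧ : ∀ {φ ψ} → Γ ∋ φ → Γ ∋ ψ → Γ ∋ φ ∧' ψ
  ∋-∧ {φ} {ψ} = ∋-by₂ (tautology (A ⇒ₛ B ⇒ₛ A ∧ₛ B) (φ ∷ ψ ∷ []))

  ∋-¬◇⋁ : ∀ K → All (λ χ → Γ ∋ ¬' ◇ χ) K → Γ ∋ ¬' ◇ ⋁ K
  ∋-¬◇⋁ []      []           = ∋-theorem ax-¬◇⊥
  ∋-¬◇⋁ (χ ∷ K) (¬◇χ∈ ∷ ¬◇K∈) =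
    ∋-by₂ (mp (tautology ((A ⇔ₛ B ∨ₛ C) ⇒ₛ ¬ₛ B ⇒ₛ ¬ₛ C ⇒ₛ ¬ₛ A)
                         (◇ (χ ∨' ⋁ K) ∷ ◇ χ ∷ ◇ ⋁ K ∷ []))
              (ax-◇∨ χ (⋁ K)))
          ¬◇χ∈ (∋-¬◇⋁ K ¬◇K∈)

infix 4 _R_

_R_ : MCS → MCS → Set
Γ R Δ = ∀ φ → Δ ∋ φ → Γ ∋ ◇ φ

R-refl : ∀ {Γ} → Γ R Γ
R-refl {Γ} φ φ∈ = ∋-by₁ Γ (ax-T φ) φ∈

R-trans : ∀ {Γ Δ Θ} → Γ R Δ → Δ R Θ → Γ R Θ
R-trans {Γ} ΓRΔ ΔRΘ φ φ∈ = ∋-by₁ Γ (ax-4 φ) (ΓRΔ (◇ φ) (ΔRΘ φ φ∈))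

-- If ◇ φ ∉ Δ then ◇ ¬ ◇ φ ∈ Γ, and with φ ∈ Γ the last axiom puts ◇ (¬ ◇ φ ∧ ◇ φ),
-- hence ◇ ⊥, into Γ.
R-sym : ∀ {Γ Δ} → Γ R Δ → Δ R Γ
R-sym {Γ} {Δ} ΓRΔ φ φ∈Γ with decides Δ (◇ φ)
... | inj₁ ◇φ∈Δ  = ◇φ∈Δ
... | inj₂ ¬◇φ∈Δ = ⊥-elim (∋-contradiction Γ ◇⊥∈Γ (∋-theorem Γ ax-¬◇⊥))
  where
  ◇⊥∈Γ : Γ ∋ ◇ ⊥'
  ◇⊥∈Γ = ∋-by₁ Γ (◇-mono (tautology (¬ₛ A ∧ₛ A ⇒ₛ ⊥ₛ) (◇ φ ∷ [])))
           (∋-by₁ Γ (ax-5 (¬' ◇ φ) φ) (∋-∧ Γ (ΓRΔ (¬' ◇ φ) ¬◇φ∈Δ) φ∈Γ))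

R-isEquivalence : IsEquivalence _R_
R-isEquivalence = record
  { refl  = λ {Γ} → R-refl {Γ}
  ; sym   = λ {Γ} {Δ} → R-sym {Γ} {Δ}
  ; trans = λ {Γ} {Δ} {Θ} → R-trans {Γ} {Δ} {Θ}
  }

module Completeness (lem : ExcludedMiddle 0ℓ) where

  extend : (Fm → Set) → Fm → Fm → Set
  extend S χ with lem {Consistent (S ∪｛ χ ｝)}
  ... | yes _ = S ∪｛ χ ｝
  ... | no _  = S ∪｛ ¬' χ ｝

  extend-⊇ : ∀ S χ {φ} → S φ → extend S χ φ
  extend-⊇ S χ φ∈ with lem {Consistent (S ∪｛ χ ｝)}
  ... | yes _ = inj₁ φ∈
  ... | no _  = inj₁ φ∈

  extend-consistent : ∀ S χ → Consistent S → Consistent (extend S χ)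
  extend-consistent S χ S-con with lem {Consistent (S ∪｛ χ ｝)}
  ... | yes S∪χ-con  = S∪χ-con
  ... | no ¬S∪χ-con = ∪｛¬｝-consistent χ S-con ¬S∪χ-con

  extend-decides : ∀ S χ → extend S χ χ ⊎ extend S χ (¬' χ)
  extend-decides S χ with lem {Consistent (S ∪｛ χ ｝)}
  ... | yes _ = inj₁ (inj₂ refl)
  ... | no _  = inj₂ (inj₂ refl)

  extendAll : List Fm → (Fm → Set) → Fm → Set
  extendAll []      S = S
  extendAll (χ ∷ L) S = extendAll L (extend S χ)

  extendAll-⊇ : ∀ L S {φ} → S φ → extendAll L S φ
  extendAll-⊇ []      S φ∈ = φ∈
  extendAll-⊇ (χ ∷ L) S φ∈ = extendAll-⊇ L (extend S χ) (extend-⊇ S χ φ∈)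

  extendAll-consistent : ∀ L S → Consistent S → Consistent (extendAll L S)
  extendAll-consistent []      S S-con = S-con
  extendAll-consistent (χ ∷ L) S S-con =
    extendAll-consistent L (extend S χ) (extend-consistent S χ S-con)

  extendAll-decides : ∀ L S {χ} → χ ∈ L → extendAll L S χ ⊎ extendAll L S (¬' χ)
  extendAll-decides (χ ∷ L) S (here refl) with extend-decides S χ
  ... | inj₁ χ∈  = inj₁ (extendAll-⊇ L (extend S χ) χ∈)
  ... | inj₂ ¬χ∈ = inj₂ (extendAll-⊇ L (extend S χ) ¬χ∈)
  extendAll-decides (_ ∷ L) S (there χ∈L) = extendAll-decides L _ χ∈L

  module Chain (S : Fm → Set) (S-con : Consistent S) where

    stage : ℕ → Fm → Set
    stage zero    = S
    stage (suc n) = extendAll (formulasBelow n) (stage n)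

    stage-consistent : ∀ n → Consistent (stage n)
    stage-consistent zero    = S-con
    stage-consistent (suc n) = extendAll-consistent (formulasBelow n) (stage n) (stage-consistent n)

    stage-mono : ∀ {m n φ} → m ≤′ n → stage m φ → stage n φ
    stage-mono ≤′-refl             φ∈ = φ∈
    stage-mono (≤′-step {n} m≤′n) φ∈ = extendAll-⊇ (formulasBelow n) (stage n) (stage-mono m≤′n φ∈)

    limit : Fm → Set
    limit φ = ∃[ n ] stage n φ

    All-limit⇒stage : ∀ L → All limit L → ∃[ n ] All (stage n) L
    All-limit⇒stage []      []                  = zero , []
    All-limit⇒stage (φ ∷ L) ((m , φ∈) ∷ L⊆limit) =
      let n , L⊆stage = All-limit⇒stage L L⊆limit
      in m ⊔ n , stage-mono (≤⇒≤′ (m≤m⊔n m n)) φ∈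
               ∷ All.map (stage-mono (≤⇒≤′ (m≤n⊔m m n))) L⊆stage

    limit-consistent : Consistent limit
    limit-consistent L L⊆limit =
      let n , L⊆stage = All-limit⇒stage L L⊆limit in stage-consistent n L L⊆stage

    limit-decides : ∀ χ → limit χ ⊎ limit (¬' χ)
    limit-decides χ with formulasBelow-complete χ
    ... | n , χ∈ with extendAll-decides (formulasBelow n) (stage n) χ∈
    ...   | inj₁ χ∈stage  = inj₁ (suc n , χ∈stage)
    ...   | inj₂ ¬χ∈stage = inj₂ (suc n , ¬χ∈stage)

  lindenbaum : ∀ S → Consistent S → ∃[ Γ ] (∀ {φ} → S φ → Γ ∋ φ)
  lindenbaum S S-con = Γ , λ φ∈S → fromWitness (zero , φ∈S)
    where
    open Chain S S-con
    Γ : MCS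
    Γ = record
      { member     = λ φ → isYes (lem {limit φ})
      ; consistent = λ L L⊆Γ → limit-consistent L (All.map toWitness L⊆Γ)
      ; decides    = λ χ → Sum.map fromWitness fromWitness (limit-decides χ)
      }

  module _ (Γ : MCS) (ψ : Fm) where

    witnessBase : Fm → Set
    witnessBase φ = φ ≡ ψ ⊎ ∃[ χ ] φ ≡ ¬' χ × Γ ∋ ¬' ◇ χ

    witnessBase-⋀ : ∀ L → All witnessBase L →
                    ∃[ K ] All (λ χ → Γ ∋ ¬' ◇ χ) K × H⊢ (ψ ∧' ¬' ⋁ K ⇒ ⋀ L)
    witnessBase-⋀ [] [] = [] , [] , tautology (A ∧ₛ ⊤ₛ ⇒ₛ ⊤ₛ) (ψ ∷ [])
    witnessBase-⋀ (φ ∷ L) (inj₁ refl ∷ L⊆base) =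
      let K , ¬◇K∈Γ , ⊢ψ∧¬⋁K⇒⋀L = witnessBase-⋀ L L⊆base
      in K , ¬◇K∈Γ ,
         mp (tautology ((A ∧ₛ ¬ₛ B ⇒ₛ C) ⇒ₛ A ∧ₛ ¬ₛ B ⇒ₛ A ∧ₛ C) (ψ ∷ ⋁ K ∷ ⋀ L ∷ [])) ⊢ψ∧¬⋁K⇒⋀L
    witnessBase-⋀ (φ ∷ L) (inj₂ (χ , refl , ¬◇χ∈Γ) ∷ L⊆base) =
      let K , ¬◇K∈Γ , ⊢ψ∧¬⋁K⇒⋀L = witnessBase-⋀ L L⊆base
      in χ ∷ K , ¬◇χ∈Γ ∷ ¬◇K∈Γ ,
         mp (tautology ((A ∧ₛ ¬ₛ B ⇒ₛ C) ⇒ₛ A ∧ₛ ¬ₛ (D ∨ₛ B) ⇒ₛ ¬ₛ D ∧ₛ C)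
                       (ψ ∷ ⋁ K ∷ ⋀ L ∷ χ ∷ []))
            ⊢ψ∧¬⋁K⇒⋀L

    -- A refutation of ψ together with the ¬ χ yields ⊢ ψ ⇒ ⋁ K, hence ◇ ⋁ K ∈ Γ.
    witnessBase-consistent : Γ ∋ ◇ ψ → Consistent witnessBase
    witnessBase-consistent ◇ψ∈Γ L L⊆base ⊢¬⋀L =
      let K , ¬◇K∈Γ , ⊢ψ∧¬⋁K⇒⋀L = witnessBase-⋀ L L⊆base
          ⊢ψ⇒⋁K = mp (mp (tautology ((A ∧ₛ ¬ₛ B ⇒ₛ C) ⇒ₛ ¬ₛ C ⇒ₛ A ⇒ₛ B) (ψ ∷ ⋁ K ∷ ⋀ L ∷ []))
                         ⊢ψ∧¬⋁K⇒⋀L)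
                     ⊢¬⋀L
      in ∋-contradiction Γ (∋-by₁ Γ (◇-mono ⊢ψ⇒⋁K) ◇ψ∈Γ) (∋-¬◇⋁ Γ K ¬◇K∈Γ)

    ◇-witness : Γ ∋ ◇ ψ → ∃[ Δ ] Γ R Δ × Δ ∋ ψ
    ◇-witness ◇ψ∈Γ =
      let Δ , base⊆Δ = lindenbaum witnessBase (witnessBase-consistent ◇ψ∈Γ)
          ΓRΔ : Γ R Δ
          ΓRΔ χ χ∈Δ =
            [ (λ ◇χ∈Γ → ◇χ∈Γ)
            , (λ ¬◇χ∈Γ → ⊥-elim (∋-contradiction Δ χ∈Δ (base⊆Δ (inj₂ (χ , refl , ¬◇χ∈Γ)))))
            ] (decides Γ (◇ χ))
      in Δ , ΓRΔ , base⊆Δ (inj₁ refl)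

  canonicalModel : Model
  canonicalModel = record { W = MCS ; R = _R_ ; V = λ p Γ → Γ ∋ var p }

  ∋⇒⊨ : ∀ φ Γ → Γ ∋ φ → canonicalModel , Γ ⊨ φ
  ⊨⇒∋ : ∀ φ Γ → canonicalModel , Γ ⊨ φ → Γ ∋ φ

  ∋⇒⊨ (var p)  Γ p∈ = p∈
  ∋⇒⊨ (¬' φ)   Γ ¬φ∈ ⊨φ = ∋-contradiction Γ (⊨⇒∋ φ Γ ⊨φ) ¬φ∈
  ∋⇒⊨ (φ ∨' ψ) Γ φ∨ψ∈ with decides Γ φ
  ... | inj₁ φ∈  = inj₁ (∋⇒⊨ φ Γ φ∈)
  ... | inj₂ ¬φ∈ = inj₂ (∋⇒⊨ ψ Γ (∋-by₂ Γ (tautology (¬ₛ A ⇒ₛ A ∨ₛ B ⇒ₛ B) (φ ∷ ψ ∷ [])) ¬φ∈ φ∨ψ∈))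
  ∋⇒⊨ (◇ φ)    Γ ◇φ∈ = let Δ , ΓRΔ , φ∈Δ = ◇-witness Γ φ ◇φ∈ in Δ , ΓRΔ , ∋⇒⊨ φ Δ φ∈Δ

  ⊨⇒∋ (var p)  Γ ⊨p = ⊨p
  ⊨⇒∋ (¬' φ)   Γ ⊭φ = [ (λ φ∈ → ⊥-elim (⊭φ (∋⇒⊨ φ Γ φ∈))) , (λ ¬φ∈ → ¬φ∈) ] (decides Γ φ)
  ⊨⇒∋ (φ ∨' ψ) Γ (inj₁ ⊨φ) = ∋-by₁ Γ (tautology (A ⇒ₛ A ∨ₛ B) (φ ∷ ψ ∷ [])) (⊨⇒∋ φ Γ ⊨φ)
  ⊨⇒∋ (φ ∨' ψ) Γ (inj₂ ⊨ψ) = ∋-by₁ Γ (tautology (B ⇒ₛ A ∨ₛ B) (φ ∷ ψ ∷ [])) (⊨⇒∋ ψ Γ ⊨ψ)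
  ⊨⇒∋ (◇ φ)    Γ (Δ , ΓRΔ , ⊨φ) = ΓRΔ φ (⊨⇒∋ φ Δ ⊨φ)

  completeness : ∀ φ → S5-valid φ → H⊢ φ
  completeness φ ⊨φ with lem {H⊢ φ}
  ... | yes ⊢φ = ⊢φ
  ... | no ⊬φ  =
    let Γ , ¬φ∈Γ = lindenbaum (_≡ ¬' φ) (｛¬｝-consistent φ ⊬φ)
    in ⊥-elim (∋⇒⊨ (¬' φ) Γ (¬φ∈Γ refl) (⊨φ canonicalModel R-isEquivalence Γ))

mainTheorem7 : ExcludedMiddle 0ℓ →
               (φ : Fm) → ((H⊢ φ → S5-valid φ) × (S5-valid φ → H⊢ φ))
mainTheorem7 lem φ = Soundness.soundness lem , Completeness.completeness lem φ
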